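{- Let $G=(V,E)$ be a connected bipartite graph of order $n=r+s\ge 4$ with stable sets $U,W$ such that $V=U\cup W$ and $1\le |U|=r\le s=|W|$. Let $S$ be an LD-code of $G$. Then $\lambda(\overline{G})\le\lambda(G)$ if any of the following conditions holds: (1) $S\cap U\neq\emptyset$ and $S\cap W\neq\emptyset$; (2) $r<s$ and $S=W$; (3) $2^r\le s$.
   Context: $\overline{G}$ denotes the complement of $G$. A set $S\subseteq V$ is a locating-dominating set (LD-set) of $G$ if every vertex of $V\setminus S$ has a neighbor in $S$ and for any two distinct $u,v\in V\setminus S$, $N_G(u)\cap S\neq N_G(v)\cap S$. The location-domination number $\lambda(G)$ is the minimum cardinality of an LD-set of $G$, and an LD-code is an LD-set of cardinality $\lambda(G)$. -}

module Defs where

open import Data.Nat using (ℕ; _≤_)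
open import Data.Bool using (Bool; true; false; not; _∧_)
open import Data.Bool.Properties using (∧-comm)
open import Data.Fin using (Fin)
open import Data.Fin.Properties using (_≟_)
open import Data.Fin.Subset using (Subset; _∈_; _∉_; ∣_∣)
open import Data.Product using (Σ; _×_; _,_)
open import Relation.Nullary using (¬_; yes; no)
open import Relation.Nullary.Decidable using (⌊_⌋)
open import Relation.Binary.PropositionalEquality using (_≡_; refl; sym; cong; cong₂)

record Graph (n : ℕ) : Set where
  field
    adj   : Fin n → Fin n → Bool
    adj-sym : ∀ u v → adj u v ≡ adj v u
    adj-irrefl : ∀ v → adj v v ≡ false
open Graph public

Adjacent : ∀ {n} → Graph n → Fin n → Fin n → Set
Adjacent G u v = adj G u v ≡ true

private
  eq-sym : ∀ {n} (u v : Fin n) → ⌊ u ≟ v ⌋ ≡ ⌊ v ≟ u ⌋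
  eq-sym u v with u ≟ v | v ≟ u
  ... | yes _ | yes _ = refl
  ... | no _  | no _  = refl
  ... | yes p | no q  with q (sym p)
  ... | ()
  eq-sym u v | no p | yes q with p (sym q)
  ... | ()

  eq-refl : ∀ {n} (v : Fin n) → ⌊ v ≟ v ⌋ ≡ true
  eq-refl v with v ≟ v
  ... | yes _ = refl
  ... | no p with p refl
  ... | ()

complement : ∀ {n} → Graph n → Graph n
complement G = record
  { adj = λ u v → not (adj G u v) ∧ not ⌊ u ≟ v ⌋
  ; adj-sym = λ u v → cong₂ (λ a b → not a ∧ not b) (Graph.adj-sym G u v) (eq-sym u v)
  ; adj-irrefl = λ v → helper (not (adj G v v)) (eq-refl v)
  }
  where
    helper : ∀ {n} {v : Fin n} (b : Bool) → ⌊ v ≟ v ⌋ ≡ true → b ∧ not ⌊ v ≟ v ⌋ ≡ false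
    helper {v = v} b e rewrite e with b
    ... | true = refl
    ... | false = refl

data Reachable {n} (G : Graph n) : Fin n → Fin n → Set where
  here : ∀ {v} → Reachable G v v
  step : ∀ {u v w} → Adjacent G u v → Reachable G v w → Reachable G u w

Connected : ∀ {n} → Graph n → Set
Connected {n} G = ∀ (u v : Fin n) → Reachable G u v

Stable : ∀ {n} → Graph n → Subset n → Set
Stable G A = ∀ u v → u ∈ A → v ∈ A → ¬ Adjacent G u v

IsLDSet : ∀ {n} → Graph n → Subset n → Set
IsLDSet {n} G S =
  (∀ (v : Fin n) → v ∉ S → Σ (Fin n) λ w → w ∈ S × Adjacent G v w)
  × (∀ (u v : Fin n) → u ∉ S → v ∉ S → ¬ u ≡ v →
       ¬ (∀ (w : Fin n) → w ∈ S → (Adjacent G u w → Adjacent G v w)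
                                × (Adjacent G v w → Adjacent G u w)))

-- LD-code: an LD-set of minimum cardinality, i.e. of cardinality λ(G).
IsLDCode : ∀ {n} → Graph n → Subset n → Set
IsLDCode {n} G S = IsLDSet G S × (∀ (T : Subset n) → IsLDSet G T → ∣ S ∣ ≤ ∣ T ∣)

module Submission where

-- Let S be an LD-code of the bipartite graph G with sides U
-- and W = ∁ U, and call a vertex v ∉ S universal for S if it is adjacent to
-- every vertex of S.
--  * If no vertex outside S is universal for S, then S is also an LD-set of
--    the complement Ḡ: complementation keeps distinct traces on S distinct and
--    turns a non-neighbour in S into a neighbour.  Hence λ(Ḡ) ≤ |S|.
--  * Otherwise let u ∉ S be universal for S.  As U and W are stable, S lies
--    entirely on the side opposite to u, which rules out condition (1).
--    If u ∈ W then S ⊆ U, and the counting bound |V ∖ S| < 2^|S| for LD-sets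
--    contradicts 2^r ≤ s.  If u ∈ U then S ⊆ W, and domination forces S = W.
--  * Finally, for S = W, u ∈ U adjacent to all of W, and r < s: were
--    λ(Ḡ) > |W|, then U would be an LD-set of G, contradicting the minimality
--    of W.  Indeed, if w₁ ≠ w₂ in W had the same neighbours in U, then w₁
--    could be dropped from W without losing separation of U, and the set
--    (W - w₁) ∪ {u} would be an LD-set of Ḡ of size at most |W|.

open import Defs
open import Data.Nat using (ℕ; zero; suc; _≤_; _<_; _^_; _+_; z≤n; s≤s; _≤?_)
open import Data.Nat.Properties
  using (≤-refl; ≤-trans; ≤-pred; ≰⇒>; +-suc; +-comm; +-identityʳ; +-monoʳ-≤; +-mono-≤;
         n≤1+n; m≤m+n; <⇒≱; <-irrefl; m^n>0; ^-monoʳ-≤; module ≤-Reasoning)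
open import Data.Bool using (Bool; true; false; not)
import Data.Bool as Bool
open import Data.Bool.Properties using (∧-identityʳ; not-injective)
open import Data.Fin using (Fin; zero; suc)
open import Data.Fin.Properties using (_≟_; any?; all?)
open import Data.Fin.Subset
  using (Subset; inside; outside; _∈_; _∉_; _⊆_; ∁; ∣_∣; _∪_; _∩_; _─_; _-_; ⁅_⁆;
         Nonempty; Empty)
open import Data.Fin.Subset.Properties
  using (_∈?_; nonempty?; x∈p∪q⁺; x∈p∪q⁻; x∈p∩q⁺; x∈p∩q⁻; x∈⁅x⁆; x∈⁅y⁆⇒x≡y;
         x∉⁅y⁆⇒x≢y; ∣⁅x⁆∣≡1; p⊆q⇒∣p∣≤∣q∣; p⊂q⇒∣p∣<∣q∣; p⊆p∪q; p─q⊆p;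
         x∈p∧x≢y⇒x∈p-y; x∈p⇒∣p-x∣<∣p∣; x∈p⇒x∉∁p; x∈∁p⇒x∉p; x∉p⇒x∈∁p; x∉∁p⇒x∈p;
         p⊆q⇒∁p⊇∁q; ⊆-antisym; drop-there)
open import Data.Vec using ([]; _∷_; here; there; tabulate)
open import Data.Vec.Properties using (lookup∘tabulate; []=⇒lookup; lookup⇒[]=)
open import Data.Product using (Σ; _×_; _,_; proj₁; proj₂)
open import Data.Sum using (_⊎_; inj₁; inj₂)
open import Data.Empty using (⊥; ⊥-elim)
open import Function using (_∘_)
open import Relation.Nullary using (¬_; yes; no)
open import Relation.Nullary.Decidable using (_×-dec_; _→-dec_; ¬?)
open import Relation.Binary.PropositionalEquality
  using (_≡_; _≢_; refl; sym; trans; cong; subst; module ≡-Reasoning)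

≡⇒↔ : ∀ {a b : Bool} → a ≡ b → (a ≡ true → b ≡ true) × (b ≡ true → a ≡ true)
≡⇒↔ refl = (λ t → t) , (λ t → t)

↔⇒≡ : ∀ {a b : Bool} → (a ≡ true → b ≡ true) → (b ≡ true → a ≡ true) → a ≡ b
↔⇒≡ {true}           to _    = sym (to refl)
↔⇒≡ {false} {true}   _  from = from refl
↔⇒≡ {false} {false}  _  _    = refl

∣p∪q∣≤∣p∣+∣q∣ : ∀ {n} (p q : Subset n) → ∣ p ∪ q ∣ ≤ ∣ p ∣ + ∣ q ∣
∣p∪q∣≤∣p∣+∣q∣ []            []            = z≤n
∣p∪q∣≤∣p∣+∣q∣ (outside ∷ p) (outside ∷ q) = ∣p∪q∣≤∣p∣+∣q∣ p q
∣p∪q∣≤∣p∣+∣q∣ (outside ∷ p) (inside  ∷ q) =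
  subst (suc ∣ p ∪ q ∣ ≤_) (sym (+-suc ∣ p ∣ ∣ q ∣)) (s≤s (∣p∪q∣≤∣p∣+∣q∣ p q))
∣p∪q∣≤∣p∣+∣q∣ (inside  ∷ p) (outside ∷ q) = s≤s (∣p∪q∣≤∣p∣+∣q∣ p q)
∣p∪q∣≤∣p∣+∣q∣ (inside  ∷ p) (inside  ∷ q) =
  s≤s (≤-trans (∣p∪q∣≤∣p∣+∣q∣ p q) (+-monoʳ-≤ ∣ p ∣ (n≤1+n ∣ q ∣)))

nonempty : ∀ {n} (p : Subset n) → 1 ≤ ∣ p ∣ → Nonempty p
nonempty (inside  ∷ p) _ = zero , here
nonempty (outside ∷ p) h with nonempty p h
... | x , x∈p = suc x , there x∈p

∣p∣≤1+∣p-x∣ : ∀ {n} (p : Subset n) (x : Fin n) → ∣ p ∣ ≤ suc ∣ p - x ∣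
∣p∣≤1+∣p-x∣ p x = begin
  ∣ p ∣                   ≤⟨ p⊆q⇒∣p∣≤∣q∣ cover ⟩
  ∣ (p - x) ∪ ⁅ x ⁆ ∣     ≤⟨ ∣p∪q∣≤∣p∣+∣q∣ (p - x) ⁅ x ⁆ ⟩
  ∣ p - x ∣ + ∣ ⁅ x ⁆ ∣   ≡⟨ cong (∣ p - x ∣ +_) (∣⁅x⁆∣≡1 x) ⟩
  ∣ p - x ∣ + 1           ≡⟨ +-comm ∣ p - x ∣ 1 ⟩
  suc ∣ p - x ∣           ∎
  where
  open ≤-Reasoning
  cover : p ⊆ (p - x) ∪ ⁅ x ⁆
  cover {y} y∈p with y ≟ x
  ... | yes refl = x∈p∪q⁺ (inj₂ (x∈⁅x⁆ x))
  ... | no y≢x   = x∈p∪q⁺ (inj₁ (x∈p∧x≢y⇒x∈p-y y∈p y≢x))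

∈─⇒∉ : ∀ {n} {x : Fin n} (p q : Subset n) → x ∈ p ─ q → x ∉ q
∈─⇒∉ {x = zero}  (_ ∷ p) (inside  ∷ q) () here
∈─⇒∉ {x = zero}  (_ ∷ p) (outside ∷ q) _  ()
∈─⇒∉ {x = suc x} (_ ∷ p) (_       ∷ q) x∈ (there x∈q) = ∈─⇒∉ p q (drop-there x∈) x∈q

∉≢∈ : ∀ {n} {A : Subset n} {x y : Fin n} → x ∉ A → y ∈ A → x ≢ y
∉≢∈ x∉A y∈A refl = x∉A y∈A

∈p-x⇒≢ : ∀ {n} {x y : Fin n} (p : Subset n) → y ∈ p - x → y ≢ x
∈p-x⇒≢ {x = x} p y∈ = x∉⁅y⁆⇒x≢y (∈─⇒∉ p ⁅ x ⁆ y∈)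

another-element : ∀ {n} (p : Subset n) (x : Fin n) → 2 ≤ ∣ p ∣ →
  Σ (Fin n) λ y → y ∈ p × y ≢ x
another-element p x 2≤∣p∣ with nonempty (p - x) (≤-pred (≤-trans 2≤∣p∣ (∣p∣≤1+∣p-x∣ p x)))
... | y , y∈p-x = y , p─q⊆p p ⁅ x ⁆ y∈p-x , ∈p-x⇒≢ p y∈p-x

subsingleton-size : ∀ {n} (p : Subset n) →
  (∀ x y → x ∈ p → y ∈ p → x ≡ y) → ∣ p ∣ ≤ 1
subsingleton-size p unique with 2 ≤? ∣ p ∣
... | no 2≰∣p∣ = ≤-pred (≰⇒> 2≰∣p∣)
... | yes 2≤∣p∣ with nonempty p (≤-trans (s≤s z≤n) 2≤∣p∣)
... | x , x∈p with another-element p x 2≤∣p∣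
... | y , y∈p , y≢x = ⊥-elim (y≢x (unique y x y∈p x∈p))

SameOn : ∀ {n} → (Fin n → Fin n → Bool) → Subset n → Fin n → Fin n → Set
SameOn {n} g A x y = ∀ (z : Fin n) → z ∈ A → g x z ≡ g y z

Separates : ∀ {n} → (Fin n → Fin n → Bool) → Subset n → Subset n → Set
Separates {n} g A B = ∀ (x y : Fin n) → x ∈ B → y ∈ B → x ≢ y → ¬ SameOn g A x y

separates-⊆ : ∀ {n} {g : Fin n → Fin n → Bool} {A B B′ : Subset n} →
  B′ ⊆ B → Separates g A B → Separates g A B′
separates-⊆ B′⊆B sep x y x∈ y∈ = sep x y (B′⊆B x∈) (B′⊆B y∈)

drop-constant-column : ∀ {n} {g : Fin n → Fin n → Bool} {A B : Subset n} {a : Fin n} (b : Bool) →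
  (∀ x → x ∈ B → g x a ≡ b) → Separates g A B → Separates g (A - a) B
drop-constant-column {g = g} {A} {a = a} b const sep x y x∈ y∈ x≢y same =
  sep x y x∈ y∈ x≢y same-on-A
  where
  same-on-A : SameOn g A x y
  same-on-A z z∈A with z ≟ a
  ... | yes refl = trans (const x x∈) (sym (const y y∈))
  ... | no z≢a   = same z (x∈p∧x≢y⇒x∈p-y z∈A z≢a)

vacuous-size : ∀ {n} {g : Fin n → Fin n → Bool} {A B : Subset n} →
  Empty A → Separates g A B → ∣ B ∣ ≤ 1
vacuous-size {B = B} empty sep = subsingleton-size B equal
  where
  equal : ∀ x y → x ∈ B → y ∈ B → x ≡ y
  equal x y x∈ y∈ with x ≟ y
  ... | yes x≡y = x≡y
  ... | no x≢y  = ⊥-elim (sep x y x∈ y∈ x≢y (λ z z∈A → ⊥-elim (empty (z , z∈A))))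

column : ∀ {n} → (Fin n → Fin n → Bool) → Fin n → Subset n
column g a = tabulate (λ x → g x a)

∈column : ∀ {n} (g : Fin n → Fin n → Bool) {a x : Fin n} → x ∈ column g a → g x a ≡ true
∈column g {a} {x} x∈ = trans (sym (lookup∘tabulate (λ y → g y a) x)) ([]=⇒lookup x∈)

∉column : ∀ {n} (g : Fin n → Fin n → Bool) {a x : Fin n} → x ∉ column g a → g x a ≡ false
∉column g {a} {x} x∉ with g x a in eq
... | true  = ⊥-elim (x∉ (lookup⇒[]= x _ (trans (lookup∘tabulate (λ y → g y a) x) eq)))
... | false = refl

-- A set of size at most k separates at most 2^k elements.  Induction on k:
-- split B according to the code at some a ∈ A and drop the column a.
separation-bound : ∀ {n} (g : Fin n → Fin n → Bool) k (A B : Subset n) →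
  ∣ A ∣ ≤ k → Separates g A B → ∣ B ∣ ≤ 2 ^ k
separation-bound g zero A B ∣A∣≤0 sep = vacuous-size no-element sep
  where
  no-element : Empty A
  no-element (a , a∈A) with ≤-trans (x∈p⇒∣p-x∣<∣p∣ a∈A) ∣A∣≤0
  ... | ()
separation-bound g (suc k) A B ∣A∣≤k+1 sep with nonempty? A
... | no empty = ≤-trans (vacuous-size empty sep) (m^n>0 2 (suc k))
... | yes (a , a∈A) = begin
  ∣ B ∣                   ≤⟨ p⊆q⇒∣p∣≤∣q∣ split ⟩
  ∣ B₁ ∪ B₀ ∣             ≤⟨ ∣p∪q∣≤∣p∣+∣q∣ B₁ B₀ ⟩
  ∣ B₁ ∣ + ∣ B₀ ∣         ≤⟨ +-mono-≤ (half B₁ true B₁⊆B B₁-true) (half B₀ false B₀⊆B B₀-false) ⟩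
  2 ^ k + 2 ^ k           ≡⟨ cong (2 ^ k +_) (sym (+-identityʳ (2 ^ k))) ⟩
  2 ^ suc k               ∎
  where
  open ≤-Reasoning
  B₁ B₀ : Subset _
  B₁ = B ∩ column g a
  B₀ = B ∩ ∁ (column g a)
  B₁⊆B : B₁ ⊆ B
  B₁⊆B x∈ = proj₁ (x∈p∩q⁻ B _ x∈)
  B₀⊆B : B₀ ⊆ B
  B₀⊆B x∈ = proj₁ (x∈p∩q⁻ B _ x∈)
  B₁-true : ∀ x → x ∈ B₁ → g x a ≡ true
  B₁-true x x∈ = ∈column g (proj₂ (x∈p∩q⁻ B _ x∈))
  B₀-false : ∀ x → x ∈ B₀ → g x a ≡ false
  B₀-false x x∈ = ∉column g (x∈∁p⇒x∉p (proj₂ (x∈p∩q⁻ B _ x∈)))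
  split : B ⊆ B₁ ∪ B₀
  split {x} x∈B with x ∈? column g a
  ... | yes x∈c = x∈p∪q⁺ (inj₁ (x∈p∩q⁺ (x∈B , x∈c)))
  ... | no x∉c  = x∈p∪q⁺ (inj₂ (x∈p∩q⁺ (x∈B , x∉p⇒x∈∁p x∉c)))
  half : ∀ B′ b → B′ ⊆ B → (∀ x → x ∈ B′ → g x a ≡ b) → ∣ B′ ∣ ≤ 2 ^ k
  half B′ b B′⊆B const = separation-bound g k (A - a) B′
    (≤-pred (≤-trans (x∈p⇒∣p-x∣<∣p∣ a∈A) ∣A∣≤k+1))
    (drop-constant-column b const (separates-⊆ B′⊆B sep))

ld-separates : ∀ {n} (G : Graph n) {S : Subset n} → IsLDSet G S → Separates (adj G) S (∁ S)
ld-separates G (_ , sep) x y x∈ y∈ x≢y same =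
  sep x y (x∈∁p⇒x∉p x∈) (x∈∁p⇒x∉p y∈) x≢y (λ w w∈ → ≡⇒↔ (same w w∈))

ld-intro : ∀ {n} (G : Graph n) {S : Subset n} →
  (∀ (v : Fin n) → v ∉ S → Σ (Fin n) λ w → w ∈ S × Adjacent G v w) →
  Separates (adj G) S (∁ S) → IsLDSet G S
ld-intro G dom sep = dom , λ x y x∉ y∉ x≢y coincide →
  sep x y (x∉p⇒x∈∁p x∉) (x∉p⇒x∈∁p y∉) x≢y
      (λ w w∈ → ↔⇒≡ (proj₁ (coincide w w∈)) (proj₂ (coincide w w∈)))

ld-nonempty : ∀ {n} (G : Graph n) {S : Subset n} → 1 ≤ n → IsLDSet G S → Nonempty S
ld-nonempty {suc n} G {S} _ (dom , _) with zero ∈? S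
... | yes 0∈S = zero , 0∈S
... | no 0∉S with dom zero 0∉S
... | w , w∈S , _ = w , w∈S

maskedAdj : ∀ {n} → Graph n → Subset n → Fin n → Fin n → Bool
maskedAdj G S x z with x ∈? S
... | yes _ = false
... | no _  = adj G x z

masked-inside : ∀ {n} (G : Graph n) {S : Subset n} {x z : Fin n} → x ∈ S → maskedAdj G S x z ≡ false
masked-inside G {S} {x} x∈S with x ∈? S
... | yes _   = refl
... | no x∉S  = ⊥-elim (x∉S x∈S)

masked-outside : ∀ {n} (G : Graph n) {S : Subset n} {x z : Fin n} → x ∉ S → maskedAdj G S x z ≡ adj G x z
masked-outside G {S} {x} x∉S with x ∈? S
... | yes x∈S = ⊥-elim (x∉S x∈S)
... | no _    = refl

-- The traces of vertices outside S
-- are distinct and, by domination, never all-false; adding one vertex x₀ ∈ S with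
-- the all-false trace gives |V ∖ S| + 1 separated vertices.
ld-size-bound : ∀ {n} (G : Graph n) (S : Subset n) → IsLDSet G S → Nonempty S →
  suc ∣ ∁ S ∣ ≤ 2 ^ ∣ S ∣
ld-size-bound G S ld@(dom , _) (x₀ , x₀∈S) =
  ≤-trans ∣∁S∣<∣B∣ (separation-bound g ∣ S ∣ S B ≤-refl separated)
  where
  g : Fin _ → Fin _ → Bool
  g = maskedAdj G S
  B : Subset _
  B = ∁ S ∪ ⁅ x₀ ⁆
  ∣∁S∣<∣B∣ : suc ∣ ∁ S ∣ ≤ ∣ B ∣
  ∣∁S∣<∣B∣ = p⊂q⇒∣p∣<∣q∣ (p⊆p∪q ⁅ x₀ ⁆ , x₀ , x∈p∪q⁺ (inj₂ (x∈⁅x⁆ x₀)) , x∈p⇒x∉∁p x₀∈S)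
  classify : ∀ {z} → z ∈ B → z ∈ ∁ S ⊎ z ≡ x₀
  classify z∈B with x∈p∪q⁻ (∁ S) ⁅ x₀ ⁆ z∈B
  ... | inj₁ z∈∁S    = inj₁ z∈∁S
  ... | inj₂ z∈⁅x₀⁆  = inj₂ (x∈⁅y⁆⇒x≡y x₀ z∈⁅x₀⁆)
  -- a vertex outside S has a neighbour in S, so its trace is not all-false
  differs-from-x₀ : ∀ {x} → x ∈ ∁ S → ¬ SameOn g S x x₀
  differs-from-x₀ {x} x∈∁S same with dom x (x∈∁p⇒x∉p x∈∁S)
  ... | w , w∈S , x~w
    with trans (sym x~w) (trans (sym (masked-outside G (x∈∁p⇒x∉p x∈∁S)))
                          (trans (same w w∈S) (masked-inside G x₀∈S)))
  ... | ()
  separated : Separates g S B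
  separated x y x∈ y∈ x≢y same with classify x∈ | classify y∈
  ... | inj₁ x∈∁S | inj₁ y∈∁S = ld-separates G ld x y x∈∁S y∈∁S x≢y λ w w∈S →
        trans (sym (masked-outside G (x∈∁p⇒x∉p x∈∁S)))
              (trans (same w w∈S) (masked-outside G (x∈∁p⇒x∉p y∈∁S)))
  ... | inj₁ x∈∁S | inj₂ refl = differs-from-x₀ x∈∁S same
  ... | inj₂ refl | inj₁ y∈∁S = differs-from-x₀ y∈∁S (λ w w∈S → sym (same w w∈S))
  ... | inj₂ refl | inj₂ refl = x≢y refl

complement-adj : ∀ {n} (G : Graph n) {u w : Fin n} → u ≢ w →
  adj (complement G) u w ≡ not (adj G u w)
complement-adj G {u} {w} u≢w with u ≟ w
... | yes u≡w = ⊥-elim (u≢w u≡w)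
... | no _    = ∧-identityʳ _

complement-sameOn : ∀ {n} (G : Graph n) {A : Subset n} {x y : Fin n} → x ∉ A → y ∉ A →
  SameOn (adj (complement G)) A x y → SameOn (adj G) A x y
complement-sameOn G {x = x} {y} x∉A y∉A same z z∈A = not-injective (begin
  not (adj G x z)         ≡⟨ sym (complement-adj G (∉≢∈ x∉A z∈A)) ⟩
  adj (complement G) x z  ≡⟨ same z z∈A ⟩
  adj (complement G) y z  ≡⟨ complement-adj G (∉≢∈ y∉A z∈A) ⟩
  not (adj G y z)         ∎)
  where open ≡-Reasoning

Universal : ∀ {n} → Graph n → Subset n → Fin n → Set
Universal {n} G S v = ∀ (w : Fin n) → w ∈ S → Adjacent G v w

universal-vertex? : ∀ {n} (G : Graph n) (S : Subset n) →
  (Σ (Fin n) λ v → v ∉ S × Universal G S v) ⊎ (∀ v → v ∉ S → ¬ Universal G S v)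
universal-vertex? G S
  with any? (λ v → ¬? (v ∈? S) ×-dec all? (λ w → (w ∈? S) →-dec (adj G v w Bool.≟ true)))
... | yes found = inj₁ found
... | no none   = inj₂ (λ v v∉S univ → none (v , v∉S , univ))

complement-LD : ∀ {n} (G : Graph n) (S : Subset n) → IsLDSet G S →
  (∀ v → v ∉ S → ¬ Universal G S v) → IsLDSet (complement G) S
complement-LD {n} G S ld none = ld-intro (complement G) dominated separated
  where
  dominated : ∀ (v : Fin n) → v ∉ S → Σ (Fin n) λ w → w ∈ S × Adjacent (complement G) v w
  dominated v v∉S with any? (λ w → (w ∈? S) ×-dec (adj G v w Bool.≟ false))
  ... | yes (w , w∈S , v≁w) = w , w∈S , trans (complement-adj G (∉≢∈ v∉S w∈S)) (cong not v≁w)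
  ... | no no-non-neighbour = ⊥-elim (none v v∉S universal)
    where
    universal : Universal G S v
    universal w w∈S with adj G v w in eq
    ... | true  = refl
    ... | false = ⊥-elim (no-non-neighbour (w , w∈S , eq))
  separated : Separates (adj (complement G)) S (∁ S)
  separated x y x∈ y∈ x≢y same = ld-separates G ld x y x∈ y∈ x≢y
    (complement-sameOn G (x∈∁p⇒x∉p x∈) (x∈∁p⇒x∉p y∈) same)

stable-nonadj : ∀ {n} (G : Graph n) {A : Subset n} {x y : Fin n} →
  Stable G A → x ∈ A → y ∈ A → adj G x y ≡ false
stable-nonadj G {x = x} {y} st x∈A y∈A with adj G x y in eq
... | true  = ⊥-elim (st x y x∈A y∈A eq)
... | false = refl

universal-avoids : ∀ {n} (G : Graph n) {A S : Subset n} {u x : Fin n} →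
  Stable G A → u ∈ A → Universal G S u → x ∈ S → x ∉ A
universal-avoids G {u = u} {x} st u∈A univ x∈S x∈A = st u x u∈A x∈A (univ x x∈S)

-- An LD-set contained in a stable set W contains all of W (it must dominate W).
ld-fills-stable : ∀ {n} (G : Graph n) {W S : Subset n} →
  Stable G W → S ⊆ W → IsLDSet G S → W ⊆ S
ld-fills-stable G {S = S} st S⊆W (dom , _) {z} z∈W with z ∈? S
... | yes z∈S = z∈S
... | no z∉S with dom z z∉S
... | w , w∈S , z~w = ⊥-elim (st z w z∈W (S⊆W w∈S) z~w)

drop-twin : ∀ {n} (G : Graph n) {A B : Subset n} {w₁ w₂ : Fin n} →
  Separates (adj G) A B → w₂ ∈ A → w₂ ≢ w₁ → SameOn (adj G) B w₁ w₂ →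
  Separates (adj G) (A - w₁) B
drop-twin G {A} {B} {w₁} {w₂} sep w₂∈A w₂≢w₁ twins x y x∈B y∈B x≢y same =
  sep x y x∈B y∈B x≢y same-on-A
  where
  same-on-A : SameOn (adj G) A x y
  same-on-A z z∈A with z ≟ w₁
  ... | no z≢w₁  = same z (x∈p∧x≢y⇒x∈p-y z∈A z≢w₁)
  ... | yes refl = begin
    adj G x z   ≡⟨ adj-sym G x z ⟩
    adj G z x   ≡⟨ twins x x∈B ⟩
    adj G w₂ x  ≡⟨ adj-sym G w₂ x ⟩
    adj G x w₂  ≡⟨ same w₂ (x∈p∧x≢y⇒x∈p-y w₂∈A w₂≢w₁) ⟩
    adj G y w₂  ≡⟨ adj-sym G y w₂ ⟩
    adj G w₂ y  ≡⟨ sym (twins y y∈B) ⟩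
    adj G z y   ≡⟨ adj-sym G z y ⟩
    adj G y z   ∎
    where open ≡-Reasoning

swap-size : ∀ {n} (A : Subset n) {w : Fin n} (u : Fin n) → w ∈ A → ∣ (A - w) ∪ ⁅ u ⁆ ∣ ≤ ∣ A ∣
swap-size A {w} u w∈A = begin
  ∣ (A - w) ∪ ⁅ u ⁆ ∣    ≤⟨ ∣p∪q∣≤∣p∣+∣q∣ (A - w) ⁅ u ⁆ ⟩
  ∣ A - w ∣ + ∣ ⁅ u ⁆ ∣  ≡⟨ cong (∣ A - w ∣ +_) (∣⁅x⁆∣≡1 u) ⟩
  ∣ A - w ∣ + 1          ≡⟨ +-comm ∣ A - w ∣ 1 ⟩
  suc ∣ A - w ∣          ≤⟨ x∈p⇒∣p-x∣<∣p∣ w∈A ⟩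
  ∣ A ∣                  ∎
  where open ≤-Reasoning

-- If W - w separates U in G, then
-- (W - w) ∪ {u} is an LD-set of Ḡ: in Ḡ, u sees all of U ∖ {u} but not w,
-- and any other vertex of W sees w.
swap-LD : ∀ {n} (G : Graph n) (U : Subset n) {u w : Fin n} →
  Stable G U → Stable G (∁ U) → 2 ≤ ∣ ∁ U ∣ →
  u ∈ U → Universal G (∁ U) u → w ∈ ∁ U →
  Separates (adj G) (∁ U - w) U → IsLDSet (complement G) ((∁ U - w) ∪ ⁅ u ⁆)
swap-LD {n} G U {u} {w} stU stW 2≤s u∈U univ w∈W sep = ld-intro Ḡ dominated separated
  where
  Ḡ : Graph n
  Ḡ = complement G
  S′ : Subset n
  S′ = (∁ U - w) ∪ ⁅ u ⁆
  u∈S′ : u ∈ S′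
  u∈S′ = x∈p∪q⁺ (inj₂ (x∈⁅x⁆ u))
  rest⊆S′ : ∁ U - w ⊆ S′
  rest⊆S′ z∈ = x∈p∪q⁺ (inj₁ z∈)
  outside-S′ : ∀ {z} → z ∉ S′ → z ≡ w ⊎ (z ∈ U × z ≢ u)
  outside-S′ {z} z∉ with z ≟ w | z ∈? U
  ... | yes z≡w | _     = inj₁ z≡w
  ... | no _    | yes z∈U = inj₂ (z∈U , λ { refl → z∉ u∈S′ })
  ... | no z≢w  | no z∉U  = ⊥-elim (z∉ (rest⊆S′ (x∈p∧x≢y⇒x∈p-y (x∉p⇒x∈∁p z∉U) z≢w)))
  u-sees-U : ∀ {z} → z ∈ U → z ≢ u → adj Ḡ z u ≡ true
  u-sees-U z∈U z≢u = trans (complement-adj G z≢u) (cong not (stable-nonadj G stU z∈U u∈U))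
  u-misses-w : adj Ḡ w u ≡ false
  u-misses-w = trans (complement-adj G (∉≢∈ (x∈∁p⇒x∉p w∈W) u∈U))
                     (cong not (trans (adj-sym G w u) (univ w w∈W)))
  dominated : ∀ (v : Fin n) → v ∉ S′ → Σ (Fin n) λ x → x ∈ S′ × Adjacent Ḡ v x
  dominated v v∉ with outside-S′ v∉
  ... | inj₂ (v∈U , v≢u) = u , u∈S′ , u-sees-U v∈U v≢u
  ... | inj₁ refl with another-element (∁ U) w 2≤s
  ... | w′ , w′∈W , w′≢w = w′ , rest⊆S′ (x∈p∧x≢y⇒x∈p-y w′∈W w′≢w) ,
        trans (complement-adj G (w′≢w ∘ sym)) (cong not (stable-nonadj G stW w∈W w′∈W))
  not-in-rest : ∀ {x} → x ∈ U → x ∉ ∁ U - w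
  not-in-rest x∈U x∈rest = x∈∁p⇒x∉p (p─q⊆p (∁ U) ⁅ w ⁆ x∈rest) x∈U
  separated : Separates (adj Ḡ) S′ (∁ S′)
  separated x y x∈ y∈ x≢y same with outside-S′ (x∈∁p⇒x∉p x∈) | outside-S′ (x∈∁p⇒x∉p y∈)
  ... | inj₁ refl | inj₁ refl = x≢y refl
  ... | inj₁ refl | inj₂ (y∈U , y≢u) with trans (sym u-misses-w) (trans (same u u∈S′) (u-sees-U y∈U y≢u))
  ... | ()
  separated x y x∈ y∈ x≢y same | inj₂ (x∈U , x≢u) | inj₁ refl
    with trans (sym u-misses-w) (trans (sym (same u u∈S′)) (u-sees-U x∈U x≢u))
  ... | ()
  separated x y x∈ y∈ x≢y same | inj₂ (x∈U , _) | inj₂ (y∈U , _) =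
    sep x y x∈U y∈U x≢y
      (complement-sameOn G (not-in-rest x∈U) (not-in-rest y∈U) (λ z z∈ → same z (rest⊆S′ z∈)))

-- Core of cases (2) and (3): S = W is an LD-code of G, r < s, and some u ∈ U
-- is adjacent to all of W.  If λ(Ḡ) > |W| then U is an LD-set of G, since twins
-- in W would yield the swap LD-set of Ḡ of size ≤ |W|; this contradicts |U| < |W|.
complement-bound-at-W : ∀ {n} (G : Graph n) (U S T : Subset n) {u : Fin n} →
  Stable G U → Stable G (∁ U) → 1 ≤ ∣ U ∣ → ∣ U ∣ < ∣ ∁ U ∣ →
  IsLDCode G S → S ≡ ∁ U → u ∈ U → Universal G S u →
  IsLDCode (complement G) T → ∣ T ∣ ≤ ∣ S ∣
complement-bound-at-W {n} G U .(∁ U) T {u} stU stW 1≤r r<s (W-LD , W-min) refl u∈U univ (_ , T-min)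
  with ∣ T ∣ ≤? ∣ ∁ U ∣
... | yes T≤W = T≤W
... | no T≰W  = ⊥-elim (<⇒≱ r<s (W-min U (ld-intro G dominated separated)))
  where
  dominated : ∀ (v : Fin n) → v ∉ U → Σ (Fin n) λ x → x ∈ U × Adjacent G v x
  dominated v v∉U = u , u∈U , trans (adj-sym G v u) (univ v (x∉p⇒x∈∁p v∉U))
  W-separates-U : Separates (adj G) (∁ U) U
  W-separates-U = separates-⊆ (x∉p⇒x∈∁p ∘ x∈p⇒x∉∁p) (ld-separates G W-LD)
  separated : Separates (adj G) U (∁ U)
  separated w₁ w₂ w₁∈W w₂∈W w₁≢w₂ twins =
    T≰W (≤-trans (T-min _ swap) (swap-size (∁ U) u w₁∈W))
    where
    swap : IsLDSet (complement G) ((∁ U - w₁) ∪ ⁅ u ⁆)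
    swap = swap-LD G U stU stW (≤-trans (s≤s 1≤r) r<s) u∈U univ w₁∈W
             (drop-twin G W-separates-U w₂∈W (w₁≢w₂ ∘ sym) twins)

small-side-impossible : ∀ {n} (G : Graph n) (U S : Subset n) →
  IsLDSet G S → Nonempty S → S ⊆ U → 2 ^ ∣ U ∣ ≤ ∣ ∁ U ∣ → ⊥
small-side-impossible G U S ld ne S⊆U 2^r≤s = <-irrefl refl (begin-strict
  ∣ ∁ S ∣      <⟨ ld-size-bound G S ld ne ⟩
  2 ^ ∣ S ∣    ≤⟨ ^-monoʳ-≤ 2 (p⊆q⇒∣p∣≤∣q∣ S⊆U) ⟩
  2 ^ ∣ U ∣    ≤⟨ 2^r≤s ⟩
  ∣ ∁ U ∣      ≤⟨ p⊆q⇒∣p∣≤∣q∣ (p⊆q⇒∁p⊇∁q S⊆U) ⟩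
  ∣ ∁ S ∣      ∎)
  where open ≤-Reasoning

n<2^n : ∀ n → n < 2 ^ n
n<2^n zero    = s≤s z≤n
n<2^n (suc n) = +-mono-≤ (m^n>0 2 n) (≤-trans (n<2^n n) (m≤m+n (2 ^ n) 0))

lemma4p1 : ∀ (n : ℕ) (G : Graph n) (U : Subset n) (S : Subset n) →
    4 ≤ n → Connected G →
    Stable G U → Stable G (∁ U) →
    1 ≤ ∣ U ∣ → ∣ U ∣ ≤ ∣ ∁ U ∣ →
    IsLDCode G S →
    ((Σ (Fin n) λ u → u ∈ S × u ∈ U) × (Σ (Fin n) λ w → w ∈ S × w ∈ ∁ U))
      ⊎ ((∣ U ∣ < ∣ ∁ U ∣ × S ≡ ∁ U) ⊎ 2 ^ ∣ U ∣ ≤ ∣ ∁ U ∣) →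
    ∀ (T : Subset n) → IsLDCode (complement G) T → ∣ T ∣ ≤ ∣ S ∣
lemma4p1 n G U S 4≤n _ stU stW 1≤r _ code cond T codeT with universal-vertex? G S
... | inj₂ none = proj₂ codeT S (complement-LD G S (proj₁ code) none)
... | inj₁ (u , u∉S , univ) with u ∈? U | cond
...   | yes u∈U | inj₁ ((a , a∈S , a∈U) , _) = ⊥-elim (universal-avoids G stU u∈U univ a∈S a∈U)
...   | no u∉U  | inj₁ (_ , (b , b∈S , b∈W)) =
        ⊥-elim (universal-avoids G stW (x∉p⇒x∈∁p u∉U) univ b∈S b∈W)
...   | yes u∈U | inj₂ (inj₁ (r<s , S≡W)) =
        complement-bound-at-W G U S T stU stW 1≤r r<s code S≡W u∈U univ codeT
...   | no u∉U  | inj₂ (inj₁ (_ , S≡W)) = ⊥-elim (u∉S (subst (u ∈_) (sym S≡W) (x∉p⇒x∈∁p u∉U)))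
...   | yes u∈U | inj₂ (inj₂ 2^r≤s) =
        complement-bound-at-W G U S T stU stW 1≤r (≤-trans (n<2^n ∣ U ∣) 2^r≤s) code S≡W u∈U univ codeT
  where
  S⊆W : S ⊆ ∁ U
  S⊆W = x∉p⇒x∈∁p ∘ universal-avoids G stU u∈U univ
  S≡W : S ≡ ∁ U
  S≡W = ⊆-antisym S⊆W (ld-fills-stable G stW S⊆W (proj₁ code))
...   | no u∉U  | inj₂ (inj₂ 2^r≤s) =
        ⊥-elim (small-side-impossible G U S (proj₁ code) (ld-nonempty G (≤-trans (s≤s z≤n) 4≤n) (proj₁ code)) S⊆U 2^r≤s)
  where
  S⊆U : S ⊆ U
  S⊆U = x∉∁p⇒x∈p ∘ universal-avoids G stW (x∉p⇒x∈∁p u∉U) univ
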